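{- Let $n\ge1$ and let $\pi=\pi_1\pi_2\cdots\pi_{2n}$ be an rc-invariant alternating permutation of $[2n]$. If $n$ is odd then $\pi_n>n\ge\pi_{n+1}$; if $n$ is even then $\pi_n\le n<\pi_{n+1}$.
   Context: A permutation $\pi\in\mathfrak{S}_{2n}$ is alternating if $\pi_1>\pi_2<\pi_3>\pi_4<\cdots$. Its complement is $\pi^c=(2n+1-\pi_1)\cdots(2n+1-\pi_{2n})$ and its reverse is $\pi^r=\pi_{2n}\cdots\pi_1$; $\pi$ is rc-invariant if $\pi^{rc}=\pi$, i.e. $\pi_i+\pi_{2n+1-i}=2n+1$ for all $i$. -}

module Defs where

open import Data.Nat using (ℕ; zero; suc; _+_; _*_; _<_; _>_; _≤_)
open import Data.Nat.DivMod using (_%_)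
open import Data.Fin using (Fin; toℕ; fromℕ<; opposite)
open import Data.Fin.Permutation using (Permutation′; _⟨$⟩ʳ_)
open import Relation.Binary.PropositionalEquality using (_≡_)
open import Data.Product using (_×_)

-- A permutation of [m] = {1,…,m} is represented by a bijection Fin m ↔ Fin m;
-- position i : Fin m stands for position toℕ i + 1, and the value there is
-- toℕ (π ⟨$⟩ʳ i) + 1 ∈ [m].
val : ∀ {m} → Permutation′ m → Fin m → ℕ
val π i = suc (toℕ (π ⟨$⟩ʳ i))

-- π_p for a 1-based position p with 1 ≤ p ≤ m (given as p = suc k, k < m).
entry : ∀ {m} → Permutation′ m → (k : ℕ) → k < m → ℕ
entry π k k<m = val π (fromℕ< k<m)

-- Alternating: π₁ > π₂ < π₃ > π₄ < ⋯.
Alternating : ∀ {m} → Permutation′ m → Set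
Alternating {m} π =
  ∀ k (k<m : k < m) (k+1<m : suc k < m) →
    (k % 2 ≡ 0 → entry π k k<m > entry π (suc k) k+1<m) ×
    (k % 2 ≡ 1 → entry π k k<m < entry π (suc k) k+1<m)

-- rc-invariant: π_i + π_{m+1-i} = m + 1 for all i (opposite i is position m+1-i).
RcInvariant : ∀ {m} → Permutation′ m → Set
RcInvariant {m} π = ∀ (i : Fin m) → val π i + val π (opposite i) ≡ suc m

{-# OPTIONS --safe #-}
module Submission where

-- The two middle positions n and n+1 are mirror images of each other, so
-- rc-invariance gives π_n + π_{n+1} = 2n+1.  Hence the larger of the two
-- entries exceeds n and the smaller is at most n; which one is larger is
-- decided by the alternating pattern at position n, i.e. by the parity of n.

open import Defs
open import Data.Nat using (ℕ; zero; suc; _+_; _*_; _<_; _>_; _≤_; _≥_; _∸_; s≤s⁻¹)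
open import Data.Nat.DivMod using (_%_)
open import Data.Nat.Properties
  using (+-identityʳ; +-comm; +-monoˡ-<; +-monoʳ-<; n<1+n; m+n∸m≡n;
         *-cancelˡ-≤; *-cancelˡ-<; module ≤-Reasoning)
open import Data.Fin using (toℕ; fromℕ<; opposite)
open import Data.Fin.Properties using (toℕ-injective; toℕ-fromℕ<; opposite-prop)
open import Data.Fin.Permutation using (Permutation′)
open import Data.Product using (_×_; _,_; proj₁; proj₂; swap)
open import Relation.Binary.PropositionalEquality
  using (_≡_; refl; sym; trans; cong; subst; module ≡-Reasoning)

suc-odd⇒even : ∀ m → suc m % 2 ≡ 1 → m % 2 ≡ 0
suc-odd⇒even zero          _  = refl
suc-odd⇒even (suc zero)    ()
suc-odd⇒even (suc (suc m)) eq = suc-odd⇒even m eq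

suc-even⇒odd : ∀ m → suc m % 2 ≡ 0 → m % 2 ≡ 1
suc-even⇒odd zero          ()
suc-even⇒odd (suc zero)    _  = refl
suc-even⇒odd (suc (suc m)) eq = suc-even⇒odd m eq

2*n≡n+n : ∀ n → 2 * n ≡ n + n
2*n≡n+n n = cong (n +_) (+-identityʳ n)

odd-sum-straddles-half : ∀ {a b n} → a + b ≡ suc (2 * n) → b < a → b ≤ n × n < a
odd-sum-straddles-half {a} {b} {n} a+b≡2n+1 b<a =
  *-cancelˡ-≤ 2 (s≤s⁻¹ 2b<2n+1) , *-cancelˡ-< 2 n a 2n<2a
  where
  open ≤-Reasoning
  2b<2n+1 : 2 * b < suc (2 * n)
  2b<2n+1 = begin-strict
    2 * b       ≡⟨ 2*n≡n+n b ⟩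
    b + b       <⟨ +-monoˡ-< b b<a ⟩
    a + b       ≡⟨ a+b≡2n+1 ⟩
    suc (2 * n) ∎
  2n<2a : 2 * n < 2 * a
  2n<2a = begin-strict
    2 * n       <⟨ n<1+n (2 * n) ⟩
    suc (2 * n) ≡⟨ sym a+b≡2n+1 ⟩
    a + b       <⟨ +-monoʳ-< a b<a ⟩
    a + a       ≡⟨ sym (2*n≡n+n a) ⟩
    2 * a       ∎

opposite-fromℕ< : ∀ {m k j} (k<m : k < m) (j<m : j < m) → suc (k + j) ≡ m →
                  opposite (fromℕ< k<m) ≡ fromℕ< j<m
opposite-fromℕ< {m} {k} {j} k<m j<m 1+k+j≡m = toℕ-injective (begin
  toℕ (opposite (fromℕ< k<m)) ≡⟨ opposite-prop (fromℕ< k<m) ⟩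
  m ∸ suc (toℕ (fromℕ< k<m))  ≡⟨ cong (λ i → m ∸ suc i) (toℕ-fromℕ< k<m) ⟩
  m ∸ suc k                            ≡⟨ cong (_∸ suc k) (sym 1+k+j≡m) ⟩
  suc k + j ∸ suc k                    ≡⟨ m+n∸m≡n (suc k) j ⟩
  j                                    ≡⟨ sym (toℕ-fromℕ< j<m) ⟩
  toℕ (fromℕ< j<m)            ∎)
  where open ≡-Reasoning

RcInvariant⇒entry-sum : ∀ {m} {π : Permutation′ m} → RcInvariant π →
                        ∀ {k j} (k<m : k < m) (j<m : j < m) → suc (k + j) ≡ m →
                        entry π k k<m + entry π j j<m ≡ suc m
RcInvariant⇒entry-sum {π = π} rc k<m j<m 1+k+j≡m =
  subst (λ i → entry π _ k<m + val π i ≡ _) (opposite-fromℕ< k<m j<m 1+k+j≡m)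
        (rc (fromℕ< k<m))

mainTheorem2 : (n : ℕ) → 1 ≤ n → (π : Permutation′ (2 * n)) →
    Alternating π → RcInvariant π →
    (n-1<2n : n ∸ 1 < 2 * n) → (n<2n : n < 2 * n) →
    (n % 2 ≡ 1 → entry π (n ∸ 1) n-1<2n > n × n ≥ entry π n n<2n) ×
    (n % 2 ≡ 0 → entry π (n ∸ 1) n-1<2n ≤ n × n < entry π n n<2n)
mainTheorem2 (suc m) _ π alt rc m<2n n<2n = odd , even
  where
  middle-sum : entry π m m<2n + entry π (suc m) n<2n ≡ suc (2 * suc m)
  middle-sum = RcInvariant⇒entry-sum {π = π} rc m<2n n<2n
                 (cong (λ i → suc (m + i)) (sym (+-identityʳ (suc m))))
  odd : suc m % 2 ≡ 1 → entry π m m<2n > suc m × suc m ≥ entry π (suc m) n<2n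
  odd n-odd = swap (odd-sum-straddles-half middle-sum
                      (proj₁ (alt m m<2n n<2n) (suc-odd⇒even m n-odd)))
  even : suc m % 2 ≡ 0 → entry π m m<2n ≤ suc m × suc m < entry π (suc m) n<2n
  even n-even = odd-sum-straddles-half
    (trans (+-comm (entry π (suc m) n<2n) (entry π m m<2n)) middle-sum)
    (proj₂ (alt m m<2n n<2n) (suc-even⇒odd m n-even))
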